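{- Let $\lambda$ be a partition with at most $n$ parts and $\beta\in U_\lambda(n)$. The row bound set $\mathcal{S}_\lambda(\beta)$ equals $\mathcal{S}_\lambda(\varphi)$ for some upper flag $\varphi\in UF_\lambda(n)$ if and only if $\beta\in UGC_\lambda(n)$. In that case one may take $\varphi:=\Phi_\lambda[\Delta_\lambda(\beta)]$, i.e. $\mathcal{S}_\lambda(\beta)=\mathcal{S}_\lambda(\Phi_\lambda[\Delta_\lambda(\beta)])$.
   Context: Fix $n\ge1$; $[m]=\{1,\dots,m\}$, $(a,b]=\{a+1,\dots,b\}$. Partition $\lambda=(\lambda_1\ge\cdots\ge\lambda_n\ge0)$; boxes $(j,i)$, $1\le j\le\lambda_1$, $1\le i\le\zeta_j=\#\{i:\lambda_i\ge j\}$. $R_\lambda=\{q_1<\cdots<q_r\}\subseteq[n-1]$ = column lengths less than $n$; $q_0=0$, $q_{r+1}=n$, $p_h=q_h-q_{h-1}$, carrels $(q_{h-1},q_h]$. $\lambda$-tuples $\nu\in[n]^n$; $U_\lambda(n)$ upper ones ($\nu_i\ge i$); $UF_\lambda(n)$ upper weakly increasing ones; $UI_\lambda(n)$ upper ones strictly increasing on each carrel. Gapless: $\gamma\in UI_\lambda(n)$ such that for each $h\in[r]$ with $\gamma_{q_h}>\gamma_{q_h+1}$, $s=\gamma_{q_h}-\gamma_{q_h+1}+1\le p_{h+1}$ and $\gamma_{q_h+t}=\gamma_{q_h}-s+t$, $t=1,\dots,s$. Critical indices of $\upsilon\in U_\lambda(n)$: in carrel $h$, $x_1=q_h$, and while possible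 $x_u$ = largest $x\in(q_{h-1},x_{u-1})$ with $\upsilon_{x_{u-1}}-\upsilon_x>x_{u-1}-x$. Core $\Delta_\lambda(\upsilon)$: equals $\upsilon_x$ at critical $x$ and $\upsilon_x-(x-i)$ at non-critical $i$, $x$ the smallest critical index $>i$. $UGC_\lambda(n)=\{\upsilon:\Delta_\lambda(\upsilon)\text{ gapless}\}$. For gapless $\gamma$: $\Phi_\lambda(\gamma)_i=\max\{\gamma_{q_h},\gamma_i\}$ if $h\in[r]$ and $q_h<i<x$ with $x$ the smallest critical index of $\gamma$ in $(q_h,q_{h+1}]$, else $\gamma_i$. Tableaux: $T_j(i)\in[n]$ strictly increasing down columns, weakly along rows; $\mathcal{T}_\lambda$. $\mathcal{S}_\lambda(\beta)=\{T\in\mathcal{T}_\lambda:T_j(i)\le\beta_i\ \forall(j,i)\}$. -}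

module Defs where

open import Data.Nat using (ℕ; zero; suc; _+_; _∸_; _≤_; _<_; _⊔_; _⊓_; _≤ᵇ_; _<ᵇ_; _≡ᵇ_; _≤?_)
open import Data.Bool using (Bool; true; false; if_then_else_; _∧_; _∨_; not)
open import Data.List using (List; []; _∷_; map; filter; length; foldr)
open import Data.Bool.ListAction using (any)
open import Data.List.Base using (upTo)
open import Data.Maybe using (Maybe; just; nothing)
open import Data.Product using (_×_; Σ; ∃)
open import Relation.Binary.PropositionalEquality using (_≡_)
open import Function.Bundles using (_⇔_)

-- Conventions: n is fixed; all n-tuples (the partition, λ-tuples, row
-- bounds) are represented as functions ℕ → ℕ using 1-based indices; only
-- the values at indices 1..n are ever inspected.  A "tableau" is a
-- function T : ℕ → ℕ → ℕ with T j i the entry in column j, row i; only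
-- its values on the boxes of the shape are inspected.

range : ℕ → List ℕ
range m = map suc (upTo m)

Partition : ℕ → (ℕ → ℕ) → Set
Partition n lam = ∀ i → 1 ≤ i → i < n → lam (suc i) ≤ lam i

colLen : ℕ → (ℕ → ℕ) → ℕ → ℕ
colLen n lam j = length (filter (λ i → j ≤? lam i) (range n))

inRᵇ : ℕ → (ℕ → ℕ) → ℕ → Bool
inRᵇ n lam q = (q <ᵇ n) ∧ any (λ j → colLen n lam j ≡ᵇ q) (range (lam 1))

isBᵇ : ℕ → (ℕ → ℕ) → ℕ → Bool
isBᵇ n lam q = (q ≡ᵇ 0) ∨ (q ≡ᵇ n) ∨ inRᵇ n lam q

firstBFrom : ℕ → (ℕ → ℕ) → ℕ → ℕ → ℕ
firstBFrom n lam k zero = k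
firstBFrom n lam k (suc fuel) =
  if isBᵇ n lam k ∨ (n ≤ᵇ k) then k else firstBFrom n lam (suc k) fuel

nextB : ℕ → (ℕ → ℕ) → ℕ → ℕ
nextB n lam q = firstBFrom n lam (suc q) n

lastBUpTo : ℕ → (ℕ → ℕ) → ℕ → ℕ
lastBUpTo n lam zero = zero
lastBUpTo n lam (suc k) = if isBᵇ n lam (suc k) then suc k else lastBUpTo n lam k

-- for i ∈ [n], the carrel containing i is (carrelStart i, carrelEnd i]
carrelStart : ℕ → (ℕ → ℕ) → ℕ → ℕ
carrelStart n lam i = lastBUpTo n lam (i ∸ 1)

carrelEnd : ℕ → (ℕ → ℕ) → ℕ → ℕ
carrelEnd n lam i = nextB n lam (carrelStart n lam i)

Tuple : ℕ → (ℕ → ℕ) → Set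
Tuple n ν = ∀ i → 1 ≤ i → i ≤ n → 1 ≤ ν i × ν i ≤ n

Upper : ℕ → (ℕ → ℕ) → Set
Upper n ν = Tuple n ν × (∀ i → 1 ≤ i → i ≤ n → i ≤ ν i)

UpperFlag : ℕ → (ℕ → ℕ) → Set
UpperFlag n ν = Upper n ν × (∀ i → 1 ≤ i → i < n → ν i ≤ ν (suc i))

-- UI_λ(n): strictly increasing on each carrel, i.e. ν_i < ν_{i+1}
-- whenever i and i+1 lie in the same carrel (i.e. i ∉ R_λ)
UpperInc : ℕ → (ℕ → ℕ) → (ℕ → ℕ) → Set
UpperInc n lam ν = Upper n ν ×
  (∀ i → 1 ≤ i → i < n → inRᵇ n lam i ≡ false → ν i < ν (suc i))

Gapless : ℕ → (ℕ → ℕ) → (ℕ → ℕ) → Set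
Gapless n lam γ = UpperInc n lam γ ×
  (∀ q → inRᵇ n lam q ≡ true → γ (suc q) < γ q →
     (suc (γ q ∸ γ (suc q)) ≤ nextB n lam q ∸ q) ×
     (∀ t → 1 ≤ t → t ≤ suc (γ q ∸ γ (suc q)) →
        γ (q + t) ≡ (γ q ∸ suc (γ q ∸ γ (suc q))) + t))

-- largest x with a < x ≤ k and υ_y - υ_x > y - x  (i.e. υ_y + x > υ_x + y)
findBelow : (ℕ → ℕ) → ℕ → ℕ → ℕ → Maybe ℕ
findBelow υ a y zero = nothing
findBelow υ a y (suc k) =
  if (a <ᵇ suc k) ∧ (υ (suc k) + y <ᵇ υ y + suc k)
  then just (suc k) else findBelow υ a y k

-- the chain x_1 = y > x_2 > ... of critical indices in (a, y]
critChainFrom : (ℕ → ℕ) → ℕ → ℕ → ℕ → List ℕ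
critChainFrom υ a y zero = y ∷ []
critChainFrom υ a y (suc fuel) with findBelow υ a y (y ∸ 1)
... | just x = y ∷ critChainFrom υ a x fuel
... | nothing = y ∷ []

critOfCarrel : ℕ → (ℕ → ℕ) → (ℕ → ℕ) → ℕ → List ℕ
critOfCarrel n lam υ i =
  critChainFrom υ (carrelStart n lam i) (carrelEnd n lam i) (carrelEnd n lam i)

critAbove : ℕ → (ℕ → ℕ) → (ℕ → ℕ) → ℕ → ℕ
critAbove n lam υ i =
  foldr _⊓_ (carrelEnd n lam i) (filter (λ x → i ≤? x) (critOfCarrel n lam υ i))

critMin : ℕ → (ℕ → ℕ) → (ℕ → ℕ) → ℕ → ℕ
critMin n lam υ i = foldr _⊓_ (carrelEnd n lam i) (critOfCarrel n lam υ i)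

core : ℕ → (ℕ → ℕ) → (ℕ → ℕ) → (ℕ → ℕ)
core n lam υ i with critAbove n lam υ i
... | x = if x ≡ᵇ i then υ i else υ x ∸ (x ∸ i)

UGC : ℕ → (ℕ → ℕ) → (ℕ → ℕ) → Set
UGC n lam υ = Upper n υ × Gapless n lam (core n lam υ)

Phi : ℕ → (ℕ → ℕ) → (ℕ → ℕ) → (ℕ → ℕ)
Phi n lam γ i =
  if inRᵇ n lam (carrelStart n lam i)
     ∧ (carrelStart n lam i <ᵇ i) ∧ (i <ᵇ critMin n lam γ i)
  then γ (carrelStart n lam i) ⊔ γ i
  else γ i

Box : ℕ → (ℕ → ℕ) → ℕ → ℕ → Set
Box n lam j i = 1 ≤ j × j ≤ lam 1 × 1 ≤ i × i ≤ colLen n lam j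

Tableau : ℕ → (ℕ → ℕ) → (ℕ → ℕ → ℕ) → Set
Tableau n lam T =
  (∀ j i → Box n lam j i → 1 ≤ T j i × T j i ≤ n) ×
  (∀ j i → Box n lam j i → Box n lam j (suc i) → T j i < T j (suc i)) ×
  (∀ j i → Box n lam j i → Box n lam (suc j) i → T j i ≤ T (suc j) i)

InS : ℕ → (ℕ → ℕ) → (ℕ → ℕ) → (ℕ → ℕ → ℕ) → Set
InS n lam β T = Tableau n lam T × (∀ j i → Box n lam j i → T j i ≤ β i)

SameS : ℕ → (ℕ → ℕ) → (ℕ → ℕ) → (ℕ → ℕ) → Set
SameS n lam β φ = ∀ T → InS n lam β T ⇔ InS n lam φ T

module Submission where

-- Write μ := Δ_λ(β).  On a carrel (a, e] the
-- core is the lower slope-one envelope of β,  μ_i = min_{i ≤ k ≤ e} β_k − (k − i),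
-- the minimum being attained at the smallest critical index c ≥ i
-- ('core-at-crit', 'core-support'; the search for critical indices is
-- analysed in 'CriticalChain').  Column entries of a tableau grow by at
-- least one per row and every column ends at a carrel boundary, so each
-- T ∈ S_λ(β) satisfies T_j(i) ≤ μ_i ('entry≤core').
--
-- Let φ be a flag with S_λ(β) = S_λ(φ).  Test
-- tableaux filling one column segment with prescribed values
-- ('TestTableau') show μ ≤ φ on carrels ending at a column length.  If μ
-- drops by d at a boundary q, the run μ_{q+1}, μ_{q+1} + 1, ..., μ_q is
-- bounded by φ, so it may not be a valid filling: hence μ returns to μ_q
-- by row q + d + 1 inside the carrel, and strict increase forces it onto
-- the slope-one line ('tight-run') — exactly the gapless shape.
--
-- For gapless μ, Φ := Φ_λ(μ) exceeds μ only
-- on recovery stretches, where it equals μ_q ('Φ-excess').  Hence Φ is a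
-- flag, and a tableau bounded by Φ is bounded by μ (climb the column to
-- the end q + s of the stretch), hence by β.

open import Defs
open import Data.Nat
open import Data.Nat.Properties
open import Data.Nat.Tactic.RingSolver using (solve-∀)
open import Data.Bool using (Bool; true; false; _∧_; T)
open import Data.Bool.Properties using (T-≡; ∨-zeroʳ; ∧-zeroʳ)
open import Data.List using (List; []; _∷_; map; filter; length; foldr; upTo; applyUpTo)
open import Data.List.Properties using (length-filter; length-map; length-applyUpTo; filter-accept; filter-reject)
open import Data.List.Membership.Propositional using (_∈_; find; lose)
open import Data.List.Membership.Propositional.Properties using (∈-map⁺; ∈-map⁻; ∈-upTo⁺; ∈-upTo⁻)
open import Data.List.Relation.Unary.Any.Properties using (any⁺; any⁻)
open import Data.List.Relation.Binary.Sublist.Propositional using (⊆-refl)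
open import Data.List.Relation.Binary.Sublist.Propositional.Properties using (filter⁺; length-mono-≤)
open import Data.Maybe using (just; nothing)
open import Data.Product using (_×_; Σ; _,_; proj₁; proj₂)
open import Data.Sum using (_⊎_; inj₁; inj₂)
open import Data.Empty using (⊥; ⊥-elim)
open import Relation.Nullary using (¬_; Dec; yes; no)
open import Relation.Nullary.Decidable using (_×-dec_)
open import Relation.Binary.PropositionalEquality
open import Function.Bundles using (_⇔_; Equivalence; mk⇔)

T⇒≡true : ∀ {b} → T b → b ≡ true
T⇒≡true = Equivalence.to T-≡

≡true⇒T : ∀ {b} → b ≡ true → T b
≡true⇒T = Equivalence.from T-≡

true≢false : ∀ {b} → b ≡ true → b ≡ false → ⊥
true≢false refl ()

≡ᵇ-refl : ∀ m → (m ≡ᵇ m) ≡ true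
≡ᵇ-refl m = T⇒≡true (≡⇒≡ᵇ m m refl)

≢⇒≡ᵇ-false : ∀ m k → m ≢ k → (m ≡ᵇ k) ≡ false
≢⇒≡ᵇ-false m k m≢k with m ≡ᵇ k in eq
... | true  = ⊥-elim (m≢k (≡ᵇ⇒≡ m k (≡true⇒T eq)))
... | false = refl

1≤-of-< : ∀ {m k} → m < k → 1 ≤ k
1≤-of-< m<k = ≤-trans (s≤s z≤n) m<k

≤pred⇒< : ∀ {k y} → 1 ≤ k → k ≤ y ∸ 1 → k < y
≤pred⇒< {y = zero}  1≤k k≤ = ⊥-elim (<⇒≱ 1≤k k≤)
≤pred⇒< {y = suc y} _   k≤ = s≤s k≤

range-length : ∀ m → length (range m) ≡ m
range-length m = trans (length-map suc (upTo m)) (length-applyUpTo (λ x → x) m)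

∈range⁺ : ∀ {m j} → 1 ≤ j → j ≤ m → j ∈ range m
∈range⁺ {j = suc j} _ j≤m = ∈-map⁺ suc (∈-upTo⁺ j≤m)

∈range⁻ : ∀ {m j} → j ∈ range m → 1 ≤ j × j ≤ m
∈range⁻ j∈ with ∈-map⁻ suc j∈
... | _ , x∈ , refl = s≤s z≤n , ∈-upTo⁻ x∈

module Carrels (n : ℕ) (lam : ℕ → ℕ) where

  cl : ℕ → ℕ
  cl = colLen n lam

  inR isB : ℕ → Bool
  inR = inRᵇ n lam
  isB = isBᵇ n lam

  cl≤n : ∀ j → cl j ≤ n
  cl≤n j = ≤-trans (length-filter (λ i → j ≤? lam i) (range n)) (≤-reflexive (range-length n))

  cl-suc≤ : ∀ j → cl (suc j) ≤ cl j
  cl-suc≤ j = length-mono-≤ (filter⁺ (λ i → suc j ≤? lam i) (λ i → j ≤? lam i)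
                               (λ { refl → <⇒≤ }) (⊆-refl {x = range n}))

  1≤cl : 1 ≤ n → ∀ j → j ≤ lam 1 → 1 ≤ cl j
  1≤cl (s≤s {n = m} _) j j≤λ₁ = subst (λ xs → 1 ≤ length xs)
    (sym (filter-accept (λ i → j ≤? lam i) {xs = map suc (applyUpTo suc m)} j≤λ₁)) (s≤s z≤n)

  inR⇒<n : ∀ q → inR q ≡ true → q < n
  inR⇒<n q e = <ᵇ⇒< q n (≡true⇒T (proj₁ (∧-true e)))
    where ∧-true : ∀ {a b} → (a ∧ b) ≡ true → a ≡ true × b ≡ true
          ∧-true {true} {true} _ = refl , refl

  inR⇒column : ∀ q → inR q ≡ true → Σ ℕ λ j → 1 ≤ j × j ≤ lam 1 × cl j ≡ q
  inR⇒column q e with q <ᵇ n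
  ... | true with find (any⁻ (λ j → cl j ≡ᵇ q) (range (lam 1)) (≡true⇒T e))
  ...   | j , j∈ , clj≡q = j , proj₁ (∈range⁻ j∈) , proj₂ (∈range⁻ j∈) , ≡ᵇ⇒≡ (cl j) q clj≡q

  column⇒inR : ∀ j → 1 ≤ j → j ≤ lam 1 → cl j < n → inR (cl j) ≡ true
  column⇒inR j 1≤j j≤λ₁ clj<n rewrite T⇒≡true (<⇒<ᵇ clj<n) =
    T⇒≡true (any⁺ (λ j' → cl j' ≡ᵇ cl j) (lose (∈range⁺ 1≤j j≤λ₁) (≡true⇒T (≡ᵇ-refl (cl j)))))

  isB-inR : ∀ q → inR q ≡ true → isB q ≡ true
  isB-inR q e rewrite e | ∨-zeroʳ (q ≡ᵇ n) = ∨-zeroʳ (q ≡ᵇ 0)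

  isB-n : isB n ≡ true
  isB-n rewrite ≡ᵇ-refl n = ∨-zeroʳ (n ≡ᵇ 0)

  isB≡inR : ∀ q → 1 ≤ q → q < n → isB q ≡ inR q
  isB≡inR q 1≤q q<n rewrite ≢⇒≡ᵇ-false q 0 (λ e → <⇒≢ 1≤q (sym e)) | ≢⇒≡ᵇ-false q n (<⇒≢ q<n) = refl

  isB-column : ∀ j → 1 ≤ j → j ≤ lam 1 → isB (cl j) ≡ true
  isB-column j 1≤j j≤λ₁ with m≤n⇒m<n∨m≡n (cl≤n j)
  ... | inj₁ clj<n = isB-inR (cl j) (column⇒inR j 1≤j j≤λ₁ clj<n)
  ... | inj₂ clj≡n = subst (λ q → isB q ≡ true) (sym clj≡n) isB-n

  lB : ℕ → ℕ
  lB = lastBUpTo n lam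

  lB-isB : ∀ k → isB (lB k) ≡ true
  lB-isB zero = refl
  lB-isB (suc k) with isB (suc k) in eq
  ... | true  = eq
  ... | false = lB-isB k

  lB≤ : ∀ k → lB k ≤ k
  lB≤ zero = z≤n
  lB≤ (suc k) with isB (suc k)
  ... | true  = ≤-refl
  ... | false = m≤n⇒m≤1+n (lB≤ k)

  lB-gap : ∀ k z → lB k < z → z ≤ k → isB z ≡ false
  lB-gap zero z lB<z z≤ = ⊥-elim (<⇒≱ lB<z z≤)
  lB-gap (suc k) z lB<z z≤ with isB (suc k) in eq
  ... | true = ⊥-elim (<⇒≱ lB<z z≤)
  ... | false with m≤n⇒m<n∨m≡n z≤
  ...   | inj₁ z<sk = lB-gap k z lB<z (≤-pred z<sk)
  ...   | inj₂ refl = eq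

  lB-unique : ∀ k b → isB b ≡ true → b ≤ k → (∀ z → b < z → z ≤ k → isB z ≡ false) → lB k ≡ b
  lB-unique zero .zero _ z≤n _ = refl
  lB-unique (suc k) b Bb b≤ gap with isB (suc k) in eq | m≤n⇒m<n∨m≡n b≤
  ... | true  | inj₁ b<sk = ⊥-elim (true≢false eq (gap (suc k) b<sk ≤-refl))
  ... | true  | inj₂ refl = refl
  ... | false | inj₁ b<sk = lB-unique k b Bb (≤-pred b<sk) (λ z b<z z≤k → gap z b<z (m≤n⇒m≤1+n z≤k))
  ... | false | inj₂ refl = ⊥-elim (true≢false Bb eq)

  IsFirstBoundaryFrom : ℕ → ℕ → Set
  IsFirstBoundaryFrom k r = k ≤ r × r ≤ n × isB r ≡ true × (∀ z → k ≤ z → z < r → isB z ≡ false)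

  firstBFrom-spec : ∀ fuel k → k ≤ n → n ≤ k + fuel → IsFirstBoundaryFrom k (firstBFrom n lam k fuel)
  firstBFrom-spec zero k k≤n n≤ with ≤-antisym k≤n (subst (n ≤_) (+-identityʳ k) n≤)
  ... | refl = ≤-refl , ≤-refl , isB-n , λ z k≤z z<k → ⊥-elim (<⇒≱ z<k k≤z)
  firstBFrom-spec (suc fuel) k k≤n n≤ with isB k in eq
  ... | true = ≤-refl , k≤n , eq , λ z k≤z z<k → ⊥-elim (<⇒≱ z<k k≤z)
  ... | false with n ≤ᵇ k in eq₂ | m≤n⇒m<n∨m≡n k≤n
  ...   | true  | _         = ⊥-elim (true≢false (subst (λ x → isB x ≡ true)
                                 (≤-antisym (≤ᵇ⇒≤ n k (≡true⇒T eq₂)) k≤n) isB-n) eq)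
  ...   | false | inj₂ refl = ⊥-elim (true≢false isB-n eq)
  ...   | false | inj₁ k<n with firstBFrom-spec fuel (suc k) k<n (subst (n ≤_) (+-suc k fuel) n≤)
  ...     | k<r , r≤n , Br , gap = <⇒≤ k<r , r≤n , Br , gap′
    where gap′ : ∀ z → k ≤ z → z < firstBFrom n lam (suc k) fuel → isB z ≡ false
          gap′ z k≤z z<r with m≤n⇒m<n∨m≡n k≤z
          ... | inj₁ k<z = gap z k<z z<r
          ... | inj₂ refl = eq

  nB : ℕ → ℕ
  nB = nextB n lam

  nB-spec : ∀ q → q < n → IsFirstBoundaryFrom (suc q) (nB q)
  nB-spec q q<n = firstBFrom-spec n (suc q) q<n (m≤n+m n (suc q))

  cs ce : ℕ → ℕ
  cs = carrelStart n lam
  ce = carrelEnd n lam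

  cs<self : ∀ i → 1 ≤ i → cs i < i
  cs<self (suc k) _ = s≤s (lB≤ k)

  cs-gap : ∀ i → 1 ≤ i → ∀ z → cs i < z → z < i → isB z ≡ false
  cs-gap (suc k) _ z cs<z z<i = lB-gap k z cs<z (≤-pred z<i)

  module _ (i : ℕ) (1≤i : 1 ≤ i) (i≤n : i ≤ n) where
    private
      ce-spec : IsFirstBoundaryFrom (suc (cs i)) (ce i)
      ce-spec = nB-spec (cs i) (<-≤-trans (cs<self i 1≤i) i≤n)

    cs<ce : cs i < ce i
    cs<ce = proj₁ ce-spec

    ce≤n : ce i ≤ n
    ce≤n = proj₁ (proj₂ ce-spec)

    ce-isB : isB (ce i) ≡ true
    ce-isB = proj₁ (proj₂ (proj₂ ce-spec))

    ce-gap : ∀ z → cs i < z → z < ce i → isB z ≡ false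
    ce-gap = proj₂ (proj₂ (proj₂ ce-spec))

    self≤ce : i ≤ ce i
    self≤ce with i ≤? ce i
    ... | yes i≤ce = i≤ce
    ... | no i≰ce = ⊥-elim (true≢false ce-isB (cs-gap i 1≤i (ce i) cs<ce (≰⇒> i≰ce)))

    ce≤boundary : ∀ b → isB b ≡ true → i ≤ b → ce i ≤ b
    ce≤boundary b Bb i≤b with ce i ≤? b
    ... | yes ce≤b = ce≤b
    ... | no ce≰b = ⊥-elim (true≢false Bb (ce-gap b (<-≤-trans (cs<self i 1≤i) i≤b) (≰⇒> ce≰b)))

    cs-same : ∀ z → cs i < z → z ≤ ce i → cs z ≡ cs i
    cs-same (suc z) cs<sz sz≤ce = lB-unique z (cs i) (lB-isB (i ∸ 1)) (≤-pred cs<sz)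
                                    (λ w cs<w w≤z → ce-gap w cs<w (<-≤-trans (s≤s w≤z) sz≤ce))

  inner-same-carrel : ∀ i → 1 ≤ i → i < n → inR i ≡ false → cs (suc i) ≡ cs i
  inner-same-carrel i 1≤i i<n notR = cs-same i 1≤i (<⇒≤ i<n) (suc i) (s≤s (<⇒≤ (cs<self i 1≤i))) i<ce
    where
      i<ce : i < ce i
      i<ce with m≤n⇒m<n∨m≡n (self≤ce i 1≤i (<⇒≤ i<n))
      ... | inj₁ lt = lt
      ... | inj₂ i≡ce = ⊥-elim (true≢false (subst (λ w → isB w ≡ true) (sym i≡ce) (ce-isB i 1≤i (<⇒≤ i<n)))
                                           (trans (isB≡inR i 1≤i i<n) notR))

-- Climbs υ x k says υ_k ≥ υ_x + (k − x): the line of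
-- slope one through (x, υ_x) passes weakly below υ at k.  Steep υ y x is the
-- test of the critical-index search: υ_y − υ_x > y − x.
Climbs : (ℕ → ℕ) → ℕ → ℕ → Set
Climbs υ x k = υ x + k ≤ υ k + x

Steep : (ℕ → ℕ) → ℕ → ℕ → Set
Steep υ y x = υ x + y < υ y + x

steep-climb : ∀ υ {x y k} → Steep υ y x → Climbs υ y k → Steep υ k x
steep-climb υ {x} {y} {k} steep climb =
  +-cancelʳ-< (υ y + y) (υ x + k) (υ k + x)
    (subst₂ _<_ (swap-inner (υ x) y (υ y) k) (swap-outer (υ y) x (υ k) y) (+-mono-<-≤ steep climb))
  where swap-inner : ∀ p q r t → p + q + (r + t) ≡ p + t + (r + q)
        swap-inner = solve-∀
        swap-outer : ∀ p q r t → p + q + (r + t) ≡ r + q + (p + t)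
        swap-outer = solve-∀

<⇒≤∸1 : ∀ {z y} → z < y → z ≤ y ∸ 1
<⇒≤∸1 {y = suc y} (s≤s z≤y) = z≤y

module CriticalChain (υ : ℕ → ℕ) (a : ℕ) where

  FoundBelow : ℕ → ℕ → ℕ → Set
  FoundBelow y k x = a < x × x ≤ k × Steep υ y x × (∀ z → x < z → z ≤ k → Climbs υ y z)

  private
    extend : ∀ {y k x} → (a < suc k → Climbs υ y (suc k)) → FoundBelow y k x → FoundBelow y (suc k) x
    extend {y} {k} {x} top (a<x , x≤k , steep , rest) = a<x , m≤n⇒m≤1+n x≤k , steep , rest′
      where rest′ : ∀ z → x < z → z ≤ suc k → Climbs υ y z
            rest′ z x<z z≤sk with m≤n⇒m<n∨m≡n z≤sk
            ... | inj₁ z<sk = rest z x<z (≤-pred z<sk)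
            ... | inj₂ refl = top (<-trans a<x x<z)

  findBelow-just : ∀ y k x → findBelow υ a y k ≡ just x → FoundBelow y k x
  findBelow-just y (suc k) x eq with (a <ᵇ suc k) in e₁ | (υ (suc k) + y <ᵇ υ y + suc k) in e₂
  ... | true | true with eq
  ...   | refl = <ᵇ⇒< a (suc k) (≡true⇒T e₁) , ≤-refl , <ᵇ⇒< _ _ (≡true⇒T e₂) , λ z x<z z≤x → ⊥-elim (<⇒≱ x<z z≤x)
  findBelow-just y (suc k) x eq | true | false =
    extend (λ _ → ≮⇒≥ λ steep → true≢false (T⇒≡true (<⇒<ᵇ steep)) e₂) (findBelow-just y k x eq)
  findBelow-just y (suc k) x eq | false | _ =
    extend (λ a<sk → ⊥-elim (true≢false (T⇒≡true (<⇒<ᵇ a<sk)) e₁)) (findBelow-just y k x eq)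

  findBelow-nothing : ∀ y k → findBelow υ a y k ≡ nothing → ∀ z → a < z → z ≤ k → Climbs υ y z
  findBelow-nothing y zero eq z a<z z≤0 = ⊥-elim (<⇒≱ a<z (≤-trans z≤0 z≤n))
  findBelow-nothing y (suc k) eq z a<z z≤sk with (a <ᵇ suc k) in e₁ | (υ (suc k) + y <ᵇ υ y + suc k) in e₂
                                                | m≤n⇒m<n∨m≡n z≤sk
  findBelow-nothing y (suc k) () z a<z z≤sk | true | true | _
  ... | true  | false | inj₁ z<sk = findBelow-nothing y k eq z a<z (≤-pred z<sk)
  ... | true  | false | inj₂ refl = ≮⇒≥ λ steep → true≢false (T⇒≡true (<⇒<ᵇ steep)) e₂
  ... | false | _     | inj₁ z<sk = findBelow-nothing y k eq z a<z (≤-pred z<sk)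
  ... | false | _     | inj₂ refl = ⊥-elim (true≢false (T⇒≡true (<⇒<ᵇ a<z)) e₁)

  found<start : ∀ y x → findBelow υ a y (y ∸ 1) ≡ just x → x < y
  found<start y x eq with findBelow-just y (y ∸ 1) x eq
  ... | a<x , x≤ , _ = ≤pred⇒< (1≤-of-< a<x) x≤

  chain : ℕ → ℕ → List ℕ
  chain y fuel = critChainFrom υ a y fuel

  chain-above-empty : ∀ fuel y i → y < i → filter (λ x → i ≤? x) (chain y fuel) ≡ []
  chain-above-empty zero y i y<i = filter-reject (λ x → i ≤? x) (<⇒≱ y<i)
  chain-above-empty (suc fuel) y i y<i with findBelow υ a y (y ∸ 1) in eq
  ... | nothing = filter-reject (λ x → i ≤? x) (<⇒≱ y<i)
  ... | just x  = trans (filter-reject (λ x → i ≤? x) (<⇒≱ y<i))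
                        (chain-above-empty fuel x i (<-trans (found<start y x eq) y<i))

  module _ (E : ℕ) where

    Supports : ℕ → ℕ → Set
    Supports m lo = ∀ k → lo ≤ k → k ≤ E → Climbs υ m k

    supports-mono : ∀ {m lo lo′} → lo ≤ lo′ → Supports m lo → Supports m lo′
    supports-mono lo≤lo′ sup k lo′≤k = sup k (≤-trans lo≤lo′ lo′≤k)

    supports-extend : ∀ y lo → Supports y y → (∀ z → lo < z → z < y → Climbs υ y z) → Supports y (suc lo)
    supports-extend y lo sup-y left k lo<k k≤E with y ≤? k
    ... | yes y≤k = sup-y k y≤k k≤E
    ... | no y≰k = left k lo<k (≰⇒> y≰k)

    steep-supports : ∀ y x → Steep υ y x → Supports y (suc x) → Supports x x
    steep-supports y x steep sup-y k x≤k k≤E with m≤n⇒m<n∨m≡n x≤k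
    ... | inj₂ refl = ≤-refl
    ... | inj₁ x<k = <⇒≤ (steep-climb υ steep (sup-y k x<k k≤E))

    minAbove : ℕ → ℕ → ℕ → ℕ
    minAbove i y fuel = foldr _⊓_ E (filter (λ x → i ≤? x) (chain y fuel))

    CritSpec : ℕ → ℕ → ℕ → Set
    CritSpec i y m = i ≤ m × m ≤ y × Supports m i

    private
      minAbove-top : ∀ {i y} rest → i ≤ y → foldr _⊓_ E (filter (λ x → i ≤? x) (y ∷ rest))
                                           ≡ y ⊓ foldr _⊓_ E (filter (λ x → i ≤? x) rest)
      minAbove-top {i} rest i≤y = cong (foldr _⊓_ E) (filter-accept (λ x → i ≤? x) {xs = rest} i≤y)

      stop : ∀ {i y} → i ≤ y → y ≤ E → Supports y i → CritSpec i y (foldr _⊓_ E (filter (λ x → i ≤? x) (y ∷ [])))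
      stop {i} {y} i≤y y≤E sup = subst (CritSpec i y) (sym (trans (minAbove-top [] i≤y) (m≤n⇒m⊓n≡m y≤E)))
                                        (i≤y , ≤-refl , sup)

    minAbove-spec : ∀ fuel y → a < y → y ≤ E → y ≤ fuel + suc a → Supports y y →
                    ∀ i → a < i → i ≤ y → CritSpec i y (minAbove i y fuel)
    minAbove-spec zero y a<y y≤E y≤sa sup-y i a<i i≤y =
      stop i≤y y≤E (supports-mono (≤-trans y≤sa a<i) sup-y)
    minAbove-spec (suc fuel) y a<y y≤E y≤ sup-y i a<i i≤y with findBelow υ a y (y ∸ 1) in eq
    ... | nothing = stop i≤y y≤E (supports-mono a<i
                      (supports-extend y a sup-y λ z a<z z<y → findBelow-nothing y (y ∸ 1) eq z a<z (<⇒≤∸1 z<y)))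
    ... | just x with findBelow-just y (y ∸ 1) x eq
    ...   | a<x , _ , steep , rest = subst (CritSpec i y) (sym (minAbove-top (chain x fuel) i≤y)) below
      where
        x<y : x < y
        x<y = found<start y x eq
        sup-y′ : Supports y (suc x)
        sup-y′ = supports-extend y x sup-y λ z x<z z<y → rest z x<z (<⇒≤∸1 z<y)
        below : CritSpec i y (y ⊓ minAbove i x fuel)
        below with i ≤? x
        ... | yes i≤x with minAbove-spec fuel x a<x (≤-trans (<⇒≤ x<y) y≤E) (≤-pred (≤-trans x<y y≤))
                             (steep-supports y x steep sup-y′) i a<i i≤x
        ...   | i≤m , m≤x , sup-m rewrite m≥n⇒m⊓n≡n (≤-trans m≤x (<⇒≤ x<y)) = i≤m , ≤-trans m≤x (<⇒≤ x<y) , sup-m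
        below | no i≰x rewrite chain-above-empty fuel x i (≰⇒> i≰x) | m≤n⇒m⊓n≡m y≤E =
          i≤y , ≤-refl , supports-mono (≰⇒> i≰x) sup-y′

  chain-skips-linear : ∀ fuel y E m → m ≤ y → y ≤ E →
                       (∀ z → a < z → z ≤ m → υ z + m ≡ υ m + z) → m ≤ foldr _⊓_ E (chain y fuel)
  chain-skips-linear zero y E m m≤y y≤E linear = ⊓-glb m≤y (≤-trans m≤y y≤E)
  chain-skips-linear (suc fuel) y E m m≤y y≤E linear with findBelow υ a y (y ∸ 1) in eq
  ... | nothing = ⊓-glb m≤y (≤-trans m≤y y≤E)
  ... | just x with findBelow-just y (y ∸ 1) x eq
  ...   | a<x , _ , steep , rest = ⊓-glb m≤y (chain-skips-linear fuel x E m m≤x (≤-trans (<⇒≤ x<y) y≤E) linear)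
    where
      x<y : x < y
      x<y = found<start y x eq
      m≤x : m ≤ x
      m≤x with m ≤? x
      ... | yes m≤x = m≤x
      ... | no m≰x = ⊥-elim (<⇒≢ steep-to-m (linear x a<x (<⇒≤ (≰⇒> m≰x))))
        where
          steep-to-m : Steep υ m x
          steep-to-m with m≤n⇒m<n∨m≡n m≤y
          ... | inj₂ refl = steep
          ... | inj₁ m<y = steep-climb υ steep (rest m (≰⇒> m≰x) (<⇒≤∸1 m<y))

strict⇒climbs : (g : ℕ → ℕ) (lo hi : ℕ) → (∀ i → lo < i → suc i ≤ hi → g i < g (suc i)) →
                ∀ i k → lo < i → i ≤ k → k ≤ hi → Climbs g i k
strict⇒climbs g lo hi inc i zero lo<i i≤0 _ = ⊥-elim (<⇒≱ lo<i (≤-trans i≤0 z≤n))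
strict⇒climbs g lo hi inc i (suc k) lo<i i≤sk sk≤hi with m≤n⇒m<n∨m≡n i≤sk
... | inj₂ refl = ≤-refl
... | inj₁ (s≤s i≤k) = begin
    g i + suc k    ≡⟨ +-suc (g i) k ⟩
    suc (g i + k)  ≤⟨ s≤s (strict⇒climbs g lo hi inc i k lo<i i≤k (≤-trans (n≤1+n k) sk≤hi)) ⟩
    suc (g k) + i  ≤⟨ +-monoˡ-≤ i (inc k (<-≤-trans lo<i i≤k) sk≤hi) ⟩
    g (suc k) + i  ∎
  where open ≤-Reasoning

climbs⇒≤ : ∀ g {i k} → i ≤ k → Climbs g i k → g i ≤ g k
climbs⇒≤ g {i} {k} i≤k climb = +-cancelʳ-≤ i (g i) (g k) (≤-trans (+-monoʳ-≤ (g i) i≤k) climb)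

column-climbs : ∀ n lam T → Tableau n lam T → ∀ j → 1 ≤ j → j ≤ lam 1 →
                ∀ i k → 1 ≤ i → i ≤ k → k ≤ colLen n lam j → Climbs (T j) i k
column-climbs n lam T (_ , col , _) j 1≤j j≤λ₁ = strict⇒climbs (T j) 0 (colLen n lam j)
  λ i 0<i si≤cl → col j i (1≤j , j≤λ₁ , 0<i , ≤-trans (n≤1+n i) si≤cl) (1≤j , j≤λ₁ , s≤s z≤n , si≤cl)

module CoreEnvelope (n : ℕ) (lam : ℕ → ℕ) (β : ℕ → ℕ) (upβ : Upper n β) where
  open Carrels n lam

  μ : ℕ → ℕ
  μ = core n lam β

  β-upper : ∀ i → 1 ≤ i → i ≤ n → i ≤ β i
  β-upper = proj₂ upβ

  β≤n : ∀ i → 1 ≤ i → i ≤ n → β i ≤ n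
  β≤n i 1≤i i≤n = proj₂ (proj₁ upβ i 1≤i i≤n)

  module _ (i : ℕ) (1≤i : 1 ≤ i) (i≤n : i ≤ n) where

    crit : ℕ
    crit = critAbove n lam β i

    private
      open CriticalChain β (cs i)
      crit-spec : CritSpec (ce i) i (ce i) crit
      crit-spec = minAbove-spec (ce i) (ce i) (ce i) (cs<ce i 1≤i i≤n) ≤-refl (m≤m+n (ce i) (suc (cs i)))
                    (λ k ce≤k k≤ce → subst (Climbs β (ce i)) (≤-antisym ce≤k k≤ce) ≤-refl)
                    i (cs<self i 1≤i) (self≤ce i 1≤i i≤n)

    self≤crit : i ≤ crit
    self≤crit = proj₁ crit-spec

    crit≤ce : crit ≤ ce i
    crit≤ce = proj₁ (proj₂ crit-spec)

    crit≤n : crit ≤ n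
    crit≤n = ≤-trans crit≤ce (ce≤n i 1≤i i≤n)

    core-at-crit : μ i + crit ≡ β crit + i
    core-at-crit with crit ≡ᵇ i in eq
    ... | true rewrite ≡ᵇ⇒≡ crit i (≡true⇒T eq) = refl
    ... | false = begin
        β crit ∸ (crit ∸ i) + crit                ≡⟨ cong (β crit ∸ (crit ∸ i) +_) (sym (m∸n+n≡m self≤crit)) ⟩
        β crit ∸ (crit ∸ i) + (crit ∸ i + i)      ≡⟨ sym (+-assoc (β crit ∸ (crit ∸ i)) (crit ∸ i) i) ⟩
        β crit ∸ (crit ∸ i) + (crit ∸ i) + i      ≡⟨ cong (_+ i) (m∸n+n≡m crit∸i≤β) ⟩
        β crit + i                                ∎
      where
        open ≡-Reasoning
        crit∸i≤β : crit ∸ i ≤ β crit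
        crit∸i≤β = ≤-trans (m∸n≤m crit i) (β-upper crit (≤-trans 1≤i self≤crit) crit≤n)

    core-support : ∀ k → i ≤ k → k ≤ ce i → μ i + k ≤ β k + i
    core-support k i≤k k≤ce = +-cancelʳ-≤ crit (μ i + k) (β k + i) (begin
        μ i + k + crit      ≡⟨ swap (μ i) k crit ⟩
        μ i + crit + k      ≡⟨ cong (_+ k) core-at-crit ⟩
        β crit + i + k      ≡⟨ swap (β crit) i k ⟩
        β crit + k + i      ≤⟨ +-monoˡ-≤ i (proj₂ (proj₂ crit-spec) k i≤k k≤ce) ⟩
        β k + crit + i      ≡⟨ swap (β k) crit i ⟩
        β k + i + crit      ∎)
      where
        open ≤-Reasoning
        swap : ∀ x y z → x + y + z ≡ x + z + y
        swap = solve-∀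

    core-upper : i ≤ μ i
    core-upper = +-cancelʳ-≤ crit i (μ i) (begin
        i + crit    ≡⟨ +-comm i crit ⟩
        crit + i    ≤⟨ +-monoˡ-≤ i (β-upper crit (≤-trans 1≤i self≤crit) crit≤n) ⟩
        β crit + i  ≡⟨ sym core-at-crit ⟩
        μ i + crit  ∎)
      where open ≤-Reasoning

    core≤β : μ i ≤ β i
    core≤β = +-cancelʳ-≤ i (μ i) (β i) (core-support i ≤-refl (self≤ce i 1≤i i≤n))

    core≤n : μ i ≤ n
    core≤n = ≤-trans core≤β (β≤n i 1≤i i≤n)

  core-Upper : Upper n μ
  core-Upper = (λ i 1≤i i≤n → ≤-trans 1≤i (core-upper i 1≤i i≤n) , core≤n i 1≤i i≤n) , core-upper

  core-strict : ∀ i → 1 ≤ i → i < n → inR i ≡ false → μ i < μ (suc i)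
  core-strict i 1≤i i<n notR = +-cancelʳ-< c (μ i) (μ (suc i)) (begin-strict
      μ i + c       ≤⟨ core-support i 1≤i (<⇒≤ i<n) c (≤-trans (n≤1+n i) (self≤crit (suc i) (s≤s z≤n) i<n)) c≤ce ⟩
      β c + i       <⟨ +-monoʳ-< (β c) (n<1+n i) ⟩
      β c + suc i   ≡⟨ sym (core-at-crit (suc i) (s≤s z≤n) i<n) ⟩
      μ (suc i) + c ∎)
    where
      open ≤-Reasoning
      c = crit (suc i) (s≤s z≤n) i<n
      c≤ce : c ≤ ce i
      c≤ce = subst (c ≤_) (cong nB (inner-same-carrel i 1≤i i<n notR)) (crit≤ce (suc i) (s≤s z≤n) i<n)

  core-inc-between : ∀ a b → b ≤ n → (∀ z → a < z → z < b → isB z ≡ false) →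
                     ∀ z → a < z → suc z ≤ b → μ z < μ (suc z)
  core-inc-between a b b≤n gap z a<z sz≤b =
    core-strict z 1≤z z<n (trans (sym (isB≡inR z 1≤z z<n)) (gap z a<z sz≤b))
    where 1≤z = 1≤-of-< a<z
          z<n = <-≤-trans sz≤b b≤n

  core-last : ∀ i → 1 ≤ i → i ≤ n → ce i ≡ n → μ i ≡ i
  core-last i 1≤i i≤n ce≡n = ≤-antisym (+-cancelʳ-≤ n (μ i) i (begin
      μ i + n   ≤⟨ core-support i 1≤i i≤n n (≤-trans (self≤ce i 1≤i i≤n) (≤-reflexive ce≡n)) (≤-reflexive (sym ce≡n)) ⟩
      β n + i   ≤⟨ +-monoˡ-≤ i (β≤n n (≤-trans 1≤i i≤n) ≤-refl) ⟩
      n + i     ≡⟨ +-comm n i ⟩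
      i + n     ∎)) (core-upper i 1≤i i≤n)
    where open ≤-Reasoning

  -- Every tableau in S_λ(β) is already bounded by the core: the critical
  -- index c ≥ i lies in the column (columns end at boundaries), and the column
  -- climbs from row i to row c.
  entry≤core : ∀ T → InS n lam β T → ∀ j i → Box n lam j i → T j i ≤ μ i
  entry≤core T (tab , bounded) j i (1≤j , j≤λ₁ , 1≤i , i≤cl) = +-cancelʳ-≤ c (T j i) (μ i) (begin
      T j i + c  ≤⟨ column-climbs n lam T tab j 1≤j j≤λ₁ i c 1≤i (self≤crit i 1≤i i≤n) c≤cl ⟩
      T j c + i  ≤⟨ +-monoˡ-≤ i (bounded j c (1≤j , j≤λ₁ , ≤-trans 1≤i (self≤crit i 1≤i i≤n) , c≤cl)) ⟩
      β c + i    ≡⟨ sym (core-at-crit i 1≤i i≤n) ⟩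
      μ i + c    ∎)
    where
      open ≤-Reasoning
      i≤n = ≤-trans i≤cl (cl≤n j)
      c = crit i 1≤i i≤n
      c≤cl : c ≤ cl j
      c≤cl = ≤-trans (crit≤ce i 1≤i i≤n) (ce≤boundary i 1≤i i≤n (cl j) (isB-column j 1≤j j≤λ₁) i≤cl)

tight-run : (g : ℕ → ℕ) (lo hi : ℕ) → (∀ i → lo < i → suc i ≤ hi → g i < g (suc i)) →
            ∀ x y → lo < x → y ≤ hi → g y + x ≤ g x + y → ∀ z → x ≤ z → z ≤ y → g z + x ≡ g x + z
tight-run g lo hi inc x y lo<x y≤hi tight z x≤z z≤y =
  ≤-antisym below-line (strict⇒climbs g lo hi inc x z lo<x x≤z (≤-trans z≤y y≤hi))
  where
    open ≤-Reasoning
    swap : ∀ p q r → p + q + r ≡ p + r + q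
    swap = solve-∀
    below-line : g z + x ≤ g x + z
    below-line = +-cancelʳ-≤ y (g z + x) (g x + z) (begin
      g z + x + y  ≡⟨ swap (g z) x y ⟩
      g z + y + x  ≤⟨ +-monoˡ-≤ x (strict⇒climbs g lo hi inc z y (<-≤-trans lo<x x≤z) z≤y y≤hi) ⟩
      g y + z + x  ≡⟨ swap (g y) z x ⟩
      g y + x + z  ≤⟨ +-monoˡ-≤ z tight ⟩
      g x + y + z  ≡⟨ swap (g x) y z ⟩
      g x + z + y  ∎)

module TestTableau (n : ℕ) (lam : ℕ → ℕ) (c a : ℕ) (f : ℕ → ℕ) where
  open Carrels n lam

  Zone : ℕ → ℕ → Set
  Zone j i = cl j ≡ c × a < i × i ≤ c

  zone? : ∀ j i → Dec (Zone j i)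
  zone? j i = (cl j ≟ c) ×-dec ((a <? i) ×-dec (i ≤? c))

  tab : ℕ → ℕ → ℕ
  tab j i with zone? j i
  ... | yes _ = f i
  ... | no _  = i

  tab-zone : ∀ j i → Zone j i → tab j i ≡ f i
  tab-zone j i z with zone? j i
  ... | yes _ = refl
  ... | no ¬z = ⊥-elim (¬z z)

  module _ (no-boundary : ∀ z → a < z → z < c → isB z ≡ false)
           (f-upper : ∀ i → a < i → i ≤ c → i ≤ f i)
           (f≤n : ∀ i → a < i → i ≤ c → f i ≤ n)
           (f-strict : ∀ i → a < i → suc i ≤ c → f i < f (suc i)) where

    tab-tableau : Tableau n lam tab
    tab-tableau = entries , columns , rows
      where
        entries : ∀ j i → Box n lam j i → 1 ≤ tab j i × tab j i ≤ n
        entries j i (_ , _ , 1≤i , i≤cl) with zone? j i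
        ... | yes (_ , a<i , i≤c) = ≤-trans 1≤i (f-upper i a<i i≤c) , f≤n i a<i i≤c
        ... | no _ = 1≤i , ≤-trans i≤cl (cl≤n j)

        columns : ∀ j i → Box n lam j i → Box n lam j (suc i) → tab j i < tab j (suc i)
        columns j i _ (_ , _ , _ , si≤cl) with zone? j i | zone? j (suc i)
        ... | yes (_ , a<i , _)   | yes (_ , _ , si≤c) = f-strict i a<i si≤c
        ... | yes (cl≡c , a<i , _) | no ¬z = ⊥-elim (¬z (cl≡c , <-trans a<i (n<1+n i) , subst (suc i ≤_) cl≡c si≤cl))
        ... | no _ | yes (_ , a<si , si≤c) = <-≤-trans (n<1+n i) (f-upper (suc i) a<si si≤c)
        ... | no _ | no _ = n<1+n i

        -- a shorter column to the right of a zone column would end inside (a, c)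
        rows : ∀ j i → Box n lam j i → Box n lam (suc j) i → tab j i ≤ tab (suc j) i
        rows j i _ (_ , sj≤λ₁ , _ , i≤cl′) with zone? j i | zone? (suc j) i
        ... | yes _ | yes _ = ≤-refl
        ... | yes (cl≡c , a<i , i≤c) | no ¬z with m≤n⇒m<n∨m≡n (subst (cl (suc j) ≤_) cl≡c (cl-suc≤ j))
        ...   | inj₂ cl′≡c = ⊥-elim (¬z (cl′≡c , a<i , i≤c))
        ...   | inj₁ cl′<c = ⊥-elim (true≢false (isB-column (suc j) (s≤s z≤n) sj≤λ₁)
                                                (no-boundary (cl (suc j)) (<-≤-trans a<i i≤cl′) cl′<c))
        rows j i _ _ | no _ | yes (_ , a<i , i≤c) = f-upper i a<i i≤c
        rows j i _ _ | no _ | no _ = ≤-refl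

    tab-in-S : ∀ b → (∀ i → 1 ≤ i → i ≤ n → i ≤ b i) → (∀ i → a < i → i ≤ c → f i ≤ b i) → InS n lam b tab
    tab-in-S b b-upper f≤b = tab-tableau , bounded
      where
        bounded : ∀ j i → Box n lam j i → tab j i ≤ b i
        bounded j i (_ , _ , 1≤i , i≤cl) with zone? j i
        ... | yes (_ , a<i , i≤c) = f≤b i a<i i≤c
        ... | no _ = b-upper i 1≤i (≤-trans i≤cl (cl≤n j))

-- x = (M − s) + t  iff  x + (q + s) = M + (q + t), when s ≤ M: the gapless
-- value formula is the statement that the points (q + t, x) lie on the
-- slope-one line through (q + s, M).
value⇔on-line : ∀ {x M s t} q → s ≤ M → (x ≡ (M ∸ s) + t) ⇔ (x + (q + s) ≡ M + (q + t))
value⇔on-line {x} {M} {s} {t} q s≤M = mk⇔ to from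
  where
    open ≡-Reasoning
    swap : ∀ p t q s → p + t + (q + s) ≡ p + s + (q + t)
    swap = solve-∀
    line : (M ∸ s) + t + (q + s) ≡ M + (q + t)
    line = trans (swap (M ∸ s) t q s) (cong (_+ (q + t)) (m∸n+n≡m s≤M))
    to : x ≡ (M ∸ s) + t → x + (q + s) ≡ M + (q + t)
    to refl = line
    from : x + (q + s) ≡ M + (q + t) → x ≡ (M ∸ s) + t
    from eq = +-cancelʳ-≡ (q + s) x ((M ∸ s) + t) (trans eq (sym line))

module CarrelAfter (n : ℕ) (lam : ℕ → ℕ) (β : ℕ → ℕ) (upβ : Upper n β) (q : ℕ) (Rq : inRᵇ n lam q ≡ true) where
  open Carrels n lam
  open CoreEnvelope n lam β upβ

  e : ℕ
  e = nB q

  q<n : q < n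
  q<n = inR⇒<n q Rq

  private
    e-spec : IsFirstBoundaryFrom (suc q) e
    e-spec = nB-spec q q<n

  q<e : q < e
  q<e = proj₁ e-spec

  e≤n : e ≤ n
  e≤n = proj₁ (proj₂ e-spec)

  e-isB : isB e ≡ true
  e-isB = proj₁ (proj₂ (proj₂ e-spec))

  e-gap : ∀ z → q < z → z < e → isB z ≡ false
  e-gap = proj₂ (proj₂ (proj₂ e-spec))

  1≤q : 1 ≤ q
  1≤q with inR⇒column q Rq
  ... | j , _ , j≤λ₁ , clj≡q = subst (1 ≤_) clj≡q (1≤cl (1≤-of-< q<n) j j≤λ₁)

  cs-in : ∀ i → q < i → i ≤ e → cs i ≡ q
  cs-in (suc i) q<si si≤e = lB-unique i q (isB-inR q Rq) (≤-pred q<si)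
                              (λ z q<z z≤i → e-gap z q<z (<-≤-trans (s≤s z≤i) si≤e))

  ce-in : ∀ i → q < i → i ≤ e → ce i ≡ e
  ce-in i q<i i≤e = cong nB (cs-in i q<i i≤e)

  core-inc : ∀ i → q < i → suc i ≤ e → μ i < μ (suc i)
  core-inc = core-inc-between q e e≤n e-gap

  core-mono : ∀ i k → q < i → i ≤ k → k ≤ e → μ i ≤ μ k
  core-mono i k q<i i≤k k≤e = climbs⇒≤ μ i≤k (strict⇒climbs μ q e core-inc i k q<i i≤k k≤e)

  -- When the core drops at q by d = μ_q − μ_{q+1}, it should recover to μ_q
  -- along a slope-one line within s = d + 1 steps.
  s : ℕ
  s = suc (μ q ∸ μ (suc q))

  Recovers : Set
  Recovers = q + s ≤ e × (∀ z → q < z → z ≤ q + s → μ z + (q + s) ≡ μ q + z)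

  GaplessValues : Set
  GaplessValues = (s ≤ e ∸ q) × (∀ t → 1 ≤ t → t ≤ s → μ (q + t) ≡ (μ q ∸ s) + t)

  module _ (drop : μ (suc q) < μ q) where

    s≤μq : s ≤ μ q
    s≤μq = ≤-trans (≤-reflexive (+-comm 1 (μ q ∸ μ (suc q))))
             (≤-trans (+-monoʳ-≤ (μ q ∸ μ (suc q)) (1≤-of-< (core-upper (suc q) (s≤s z≤n) q<n)))
                      (≤-reflexive (m∸n+n≡m (<⇒≤ drop))))

    recovers⇔gapless : Recovers ⇔ GaplessValues
    recovers⇔gapless = mk⇔ to from
      where
        to : Recovers → GaplessValues
        to (qs≤e , line) = ≤-trans (≤-reflexive (sym (m+n∸m≡n q s))) (∸-monoˡ-≤ q qs≤e) ,
          λ t 1≤t t≤s → Equivalence.from (value⇔on-line q s≤μq)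
                           (line (q + t) (m<m+n q 1≤t) (+-monoʳ-≤ q t≤s))
        from : GaplessValues → Recovers
        from (s≤e∸q , value) = ≤-trans (+-monoʳ-≤ q s≤e∸q) (≤-reflexive (m+[n∸m]≡n (<⇒≤ q<e))) , line
          where
            line : ∀ z → q < z → z ≤ q + s → μ z + (q + s) ≡ μ q + z
            line z q<z z≤qs = subst (λ w → μ w + (q + s) ≡ μ q + w) (m+[n∸m]≡n (<⇒≤ q<z))
              (Equivalence.to (value⇔on-line q s≤μq)
                 (value (z ∸ q) (m<n⇒0<n∸m q<z) (≤-trans (∸-monoˡ-≤ q z≤qs) (≤-reflexive (m+n∸m≡n q s)))))

    recovered : Recovers → μ (q + s) ≡ μ q
    recovered (_ , line) = +-cancelʳ-≡ (q + s) (μ (q + s)) (μ q) (line (q + s) (m<m+n q (s≤s z≤n)) ≤-refl)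

module Necessity (n : ℕ) (lam : ℕ → ℕ) (β : ℕ → ℕ) (upβ : Upper n β)
                 (φ : ℕ → ℕ) (flag : UpperFlag n φ) (same : SameS n lam β φ) where
  open Carrels n lam
  open CoreEnvelope n lam β upβ

  φ-upper : ∀ i → 1 ≤ i → i ≤ n → i ≤ φ i
  φ-upper = proj₂ (proj₁ flag)

  φ-mono : ∀ i k → 1 ≤ i → i ≤ k → k ≤ n → φ i ≤ φ k
  φ-mono i zero 1≤i i≤0 _ = ⊥-elim (<⇒≱ 1≤i i≤0)
  φ-mono i (suc k) 1≤i i≤sk sk≤n with m≤n⇒m<n∨m≡n i≤sk
  ... | inj₂ refl = ≤-refl
  ... | inj₁ (s≤s i≤k) = ≤-trans (φ-mono i k 1≤i i≤k (≤-trans (n≤1+n k) sk≤n))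
                                 (proj₂ flag k (≤-trans 1≤i i≤k) sk≤n)

  -- On a carrel ending at a column length the core lies below φ: the test
  -- tableau carrying μ on that carrel is in S_λ(β), hence in S_λ(φ).
  core≤φ : ∀ i → 1 ≤ i → i ≤ n → inR (ce i) ≡ true → μ i ≤ φ i
  core≤φ i 1≤i i≤n R with inR⇒column (ce i) R
  ... | j , 1≤j , j≤λ₁ , clj≡ce =
    subst (_≤ φ i) (tab-zone j i (clj≡ce , cs<self i 1≤i , self≤ce i 1≤i i≤n))
      (proj₂ (Equivalence.to (same tab) tab∈Sβ) j i (1≤j , j≤λ₁ , 1≤i , subst (i ≤_) (sym clj≡ce) (self≤ce i 1≤i i≤n)))
    where
      open TestTableau n lam (ce i) (cs i) μ
      ≤n : ∀ z → z ≤ ce i → z ≤ n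
      ≤n z z≤ce = ≤-trans z≤ce (ce≤n i 1≤i i≤n)
      tab∈Sβ : InS n lam β tab
      tab∈Sβ = tab-in-S (ce-gap i 1≤i i≤n)
        (λ z cs<z z≤ce → core-upper z (1≤-of-< cs<z) (≤n z z≤ce))
        (λ z cs<z z≤ce → core≤n z (1≤-of-< cs<z) (≤n z z≤ce))
        (core-inc-between (cs i) (ce i) (ce≤n i 1≤i i≤n) (ce-gap i 1≤i i≤n))
        β β-upper (λ z cs<z z≤ce → core≤β z (1≤-of-< cs<z) (≤n z z≤ce))

  module AtDrop (q : ℕ) (Rq : inR q ≡ true) (drop : μ (suc q) < μ q) where
    open CarrelAfter n lam β upβ q Rq

    d : ℕ
    d = μ q ∸ μ (suc q)

    μq≡ : μ (suc q) + d ≡ μ q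
    μq≡ = m+[n∸m]≡n (<⇒≤ drop)

    -- On the last carrel the core is the identity, so q + s = μ_q.
    last-carrel-bound : e ≡ n → q + s ≤ e × μ (q + s) ≤ μ q
    last-carrel-bound e≡n = qs≤e , ≤-reflexive (trans μqs≡qs qs≡μq)
      where
        μsq≡sq : μ (suc q) ≡ suc q
        μsq≡sq = core-last (suc q) (s≤s z≤n) q<n (trans (ce-in (suc q) (n<1+n q) q<e) e≡n)
        qs≡μq : q + s ≡ μ q
        qs≡μq = trans (cong (λ x → q + suc (μ q ∸ x)) μsq≡sq)
                      (trans (+-suc q (μ q ∸ suc q)) (m+[n∸m]≡n (<⇒≤ (subst (_< μ q) μsq≡sq drop))))
        qs≤e : q + s ≤ e
        qs≤e = subst₂ _≤_ (sym qs≡μq) (sym e≡n) (core≤n q 1≤q (<⇒≤ q<n))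
        μqs≡qs : μ (q + s) ≡ q + s
        μqs≡qs = core-last (q + s) (1≤-of-< (m<m+n q (s≤s z≤n))) (≤-trans qs≤e e≤n)
                   (trans (ce-in (q + s) (m<m+n q (s≤s z≤n)) qs≤e) e≡n)

    module InnerCarrel (e<n : e < n) where
      Re : inR e ≡ true
      Re = trans (sym (isB≡inR e (1≤-of-< q<e) e<n)) e-isB

      core≤φ-after : ∀ i → q < i → i ≤ e → μ i ≤ φ i
      core≤φ-after i q<i i≤e = core≤φ i (1≤-of-< q<i) (≤-trans i≤e e≤n)
                                  (subst (λ x → inR x ≡ true) (sym (ce-in i q<i i≤e)) Re)

      μq≤φq : μ q ≤ φ q
      μq≤φq = core≤φ q 1≤q (<⇒≤ q<n) (subst (λ x → inR x ≡ true) (sym ce-q) Rq)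
        where ce-q : ce q ≡ q
              ce-q = ≤-antisym (ce≤boundary q 1≤q (<⇒≤ q<n) q (isB-inR q Rq) ≤-refl) (self≤ce q 1≤q (<⇒≤ q<n))

      -- the fastest admissible run from μ_{q+1}; it reaches μ_q at row q + d
      run : ℕ → ℕ
      run i with i <? q + s
      ... | yes _ = μ (suc q) + (i ∸ q)
      ... | no _  = μ i

      run≤μq : ∀ i → q ≤ i → i < q + s → μ (suc q) + (i ∸ q) ≤ μ q
      run≤μq i q≤i i<qs = ≤-trans (+-monoʳ-≤ (μ (suc q)) i∸q≤d) (≤-reflexive μq≡)
        where i∸q≤d : i ∸ q ≤ d
              i∸q≤d = ≤-trans (∸-monoˡ-≤ q (≤-pred (subst (i <_) (+-suc q d) i<qs))) (≤-reflexive (m+n∸m≡n q d))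

      run-upper : ∀ i → q < i → i ≤ e → i ≤ run i
      run-upper i q<i i≤e with i <? q + s
      ... | yes _ = subst (_≤ μ (suc q) + (i ∸ q)) (m+[n∸m]≡n (<⇒≤ q<i))
                      (+-monoˡ-≤ (i ∸ q) (<⇒≤ (core-upper (suc q) (s≤s z≤n) q<n)))
      ... | no _ = core-upper i (1≤-of-< q<i) (≤-trans i≤e e≤n)

      run≤n : ∀ i → q < i → i ≤ e → run i ≤ n
      run≤n i q<i i≤e with i <? q + s
      ... | yes i<qs = ≤-trans (run≤μq i (<⇒≤ q<i) i<qs) (core≤n q 1≤q (<⇒≤ q<n))
      ... | no _ = core≤n i (1≤-of-< q<i) (≤-trans i≤e e≤n)

      run≤φ : ∀ i → q < i → i ≤ e → run i ≤ φ i
      run≤φ i q<i i≤e with i <? q + s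
      ... | yes i<qs = ≤-trans (run≤μq i (<⇒≤ q<i) i<qs)
                         (≤-trans μq≤φq (φ-mono q i 1≤q (<⇒≤ q<i) (≤-trans i≤e e≤n)))
      ... | no _ = core≤φ-after i q<i i≤e

      run-strict : (q + s ≤ e → μ q < μ (q + s)) → ∀ i → q < i → suc i ≤ e → run i < run (suc i)
      run-strict late i q<i si≤e with i <? q + s | suc i <? q + s
      ... | yes _ | yes _ = +-monoʳ-< (μ (suc q)) (≤-reflexive (sym (+-∸-assoc 1 (<⇒≤ q<i))))
      ... | yes i<qs | no si≮qs = subst (λ x → μ (suc q) + (i ∸ q) < μ x) (sym si≡qs)
            (<-≤-trans (s≤s (run≤μq i (<⇒≤ q<i) i<qs)) (late (subst (_≤ e) si≡qs si≤e)))
        where si≡qs : suc i ≡ q + s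
              si≡qs = ≤-antisym i<qs (≮⇒≥ si≮qs)
      ... | no i≮qs | yes si<qs = ⊥-elim (i≮qs (<-trans (n<1+n i) si<qs))
      ... | no _ | no _ = core-inc i q<i si≤e

      run-start : run (suc q) ≡ μ (suc q) + 1
      run-start with suc q <? q + s
      ... | yes _ = cong (μ (suc q) +_) (m+n∸n≡m 1 q)
      ... | no sq≮qs = ⊥-elim (sq≮qs sq<qs)
        where sq<qs : suc q < q + s
              sq<qs = subst (suc q <_) (sym (+-suc q d)) (s≤s (m<m+n q (m<n⇒0<n∸m drop)))

      -- If the core had not recovered by row q + s, filling rows (q, e] of a
      -- column of length e with the run would give a tableau bounded by φ,
      -- hence by β, whose entry μ_{q+1} + 1 in row q + 1 exceeds the core.
      no-late-recovery : (q + s ≤ e → μ q < μ (q + s)) → ⊥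
      no-late-recovery late with inR⇒column e Re
      ... | je , 1≤je , je≤λ₁ , clje≡e = m+1+n≰m (μ (suc q)) (subst (_≤ μ (suc q)) entry
            (entry≤core tab tab∈Sβ je (suc q) (1≤je , je≤λ₁ , s≤s z≤n , subst (suc q ≤_) (sym clje≡e) q<e)))
        where
          open TestTableau n lam e q run
          tab∈Sβ : InS n lam β tab
          tab∈Sβ = Equivalence.from (same tab) (tab-in-S e-gap run-upper run≤n (run-strict late) φ φ-upper run≤φ)
          entry : tab je (suc q) ≡ μ (suc q) + 1
          entry = trans (tab-zone je (suc q) (clje≡e , n<1+n q , q<e)) run-start

      inner-recovery-bound : q + s ≤ e × μ (q + s) ≤ μ q
      inner-recovery-bound with q + s ≤? e
      ... | no qs≰e = ⊥-elim (no-late-recovery (λ qs≤e → ⊥-elim (qs≰e qs≤e)))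
      ... | yes qs≤e with μ q <? μ (q + s)
      ...   | yes late = ⊥-elim (no-late-recovery (λ _ → late))
      ...   | no ¬late = qs≤e , ≮⇒≥ ¬late

    recovery-bound : q + s ≤ e × μ (q + s) ≤ μ q
    recovery-bound with e ≟ n
    ... | yes e≡n = last-carrel-bound e≡n
    ... | no e≢n = InnerCarrel.inner-recovery-bound (≤∧≢⇒< e≤n e≢n)

    -- Being strictly increasing from q + 1 yet gaining at most d by row
    -- q + s, the core runs along the slope-one line to μ_q.
    recovers : Recovers
    recovers = qs≤e , on-line
      where
        qs≤e = proj₁ recovery-bound
        open ≡-Reasoning
        shift : ∀ x q d → x + (q + suc d) ≡ x + suc q + d
        shift = solve-∀
        regroup : ∀ u z d → u + z + d ≡ u + d + z
        regroup = solve-∀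
        absorb : ∀ u d q → u + d + suc q ≡ u + (q + suc d)
        absorb = solve-∀
        tight : μ (q + s) + suc q ≤ μ (suc q) + (q + s)
        tight = ≤-trans (+-monoˡ-≤ (suc q) (proj₂ recovery-bound)) (≤-reflexive (begin
          μ q + suc q               ≡⟨ cong (_+ suc q) (sym μq≡) ⟩
          μ (suc q) + d + suc q     ≡⟨ absorb (μ (suc q)) d q ⟩
          μ (suc q) + (q + suc d)   ∎))
        on-line : ∀ z → q < z → z ≤ q + s → μ z + (q + s) ≡ μ q + z
        on-line z q<z z≤qs = begin
          μ z + (q + s)             ≡⟨ shift (μ z) q d ⟩
          μ z + suc q + d           ≡⟨ cong (_+ d) (tight-run μ q e core-inc (suc q) (q + s) (n<1+n q) qs≤e tight z q<z z≤qs) ⟩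
          μ (suc q) + z + d         ≡⟨ regroup (μ (suc q)) z d ⟩
          μ (suc q) + d + z         ≡⟨ cong (_+ z) μq≡ ⟩
          μ q + z                   ∎

  core-gapless : Gapless n lam μ
  core-gapless = (core-Upper , core-strict) ,
    λ q Rq drop → Equivalence.to (CarrelAfter.recovers⇔gapless n lam β upβ q Rq drop) (AtDrop.recovers q Rq drop)

module Sufficiency (n : ℕ) (lam : ℕ → ℕ) (β : ℕ → ℕ) (upβ : Upper n β)
                   (gapless : Gapless n lam (core n lam β)) where
  open Carrels n lam
  open CoreEnvelope n lam β upβ

  Φ : ℕ → ℕ
  Φ = Phi n lam μ

  cmin : ℕ → ℕ
  cmin = critMin n lam μ

  stretch : ℕ → ℕ
  stretch a = suc (μ a ∸ μ (suc a))

  Φ-lowered : ∀ i → ¬ (i < cmin i) → Φ i ≡ μ i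
  Φ-lowered i i≮cmin with i <ᵇ cmin i in eq
  ... | true = ⊥-elim (i≮cmin (<ᵇ⇒< i (cmin i) (≡true⇒T eq)))
  ... | false rewrite ∧-zeroʳ (cs i <ᵇ i) | ∧-zeroʳ (inR (cs i)) = refl

  Φ-raised : ∀ i → inR (cs i) ≡ true → cs i < i → i < cmin i → Φ i ≡ μ (cs i) ⊔ μ i
  Φ-raised i R cs<i i<cmin rewrite R | T⇒≡true (<⇒<ᵇ cs<i) | T⇒≡true (<⇒<ᵇ i<cmin) = refl

  Φ-outside : ∀ i → inR (cs i) ≡ false → Φ i ≡ μ i
  Φ-outside i notR rewrite notR = refl

  Φ-unfold : ∀ i → 1 ≤ i → (Φ i ≡ μ i) ⊎ (inR (cs i) ≡ true × i < cmin i × Φ i ≡ μ (cs i) ⊔ μ i)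
  Φ-unfold i 1≤i = unfold (inR (cs i)) refl (i <? cmin i)
    where
      unfold : ∀ b → inR (cs i) ≡ b → Dec (i < cmin i) →
               (Φ i ≡ μ i) ⊎ (inR (cs i) ≡ true × i < cmin i × Φ i ≡ μ (cs i) ⊔ μ i)
      unfold false notR _ = inj₁ (Φ-outside i notR)
      unfold true R (no i≮cmin) = inj₁ (Φ-lowered i i≮cmin)
      unfold true R (yes i<cmin) = inj₂ (R , i<cmin , Φ-raised i R (cs<self i 1≤i) i<cmin)

  core≤Φ : ∀ i → 1 ≤ i → μ i ≤ Φ i
  core≤Φ i 1≤i with Φ-unfold i 1≤i
  ... | inj₁ Φi≡μi = ≤-reflexive (sym Φi≡μi)
  ... | inj₂ (_ , _ , Φi≡) = ≤-trans (m≤n⊔m (μ (cs i)) (μ i)) (≤-reflexive (sym Φi≡))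

  module AfterDrop (a : ℕ) (Ra : inR a ≡ true) (drop : μ (suc a) < μ a) where
    open CarrelAfter n lam β upβ a Ra public

    recovery : Recovers
    recovery = Equivalence.from (recovers⇔gapless drop) (proj₂ gapless a Ra drop)

    as≤e : a + s ≤ e
    as≤e = proj₁ recovery

    on-line : ∀ z → a < z → z ≤ a + s → μ z + (a + s) ≡ μ a + z
    on-line = proj₂ recovery

    μas≡μa : μ (a + s) ≡ μ a
    μas≡μa = recovered drop recovery

    stretch≤cmin : ∀ i → a < i → i ≤ e → a + s ≤ cmin i
    stretch≤cmin i a<i i≤e =
      subst (a + s ≤_) (cong (λ c → foldr _⊓_ (nB c) (critChainFrom μ c (nB c) (nB c))) (sym (cs-in i a<i i≤e)))
        (CriticalChain.chain-skips-linear μ a e e e (a + s) as≤e ≤-refl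
          λ z a<z z≤as → trans (on-line z a<z z≤as) (cong (_+ z) (sym μas≡μa)))

    μa≤Φ : ∀ i → a < i → i ≤ a + s → μ a ≤ Φ i
    μa≤Φ i a<i i≤as with m≤n⇒m<n∨m≡n i≤as
    ... | inj₂ refl = ≤-trans (≤-reflexive (sym μas≡μa)) (core≤Φ (a + s) (1≤-of-< a<i))
    ... | inj₁ i<as = ≤-trans (≤-reflexive (cong μ (sym cs≡a))) (≤-trans (m≤m⊔n (μ (cs i)) (μ i))
                        (≤-reflexive (sym (Φ-raised i (trans (cong inR cs≡a) Ra) (subst (_< i) (sym cs≡a) a<i)
                                             (<-≤-trans i<as (stretch≤cmin i a<i i≤e))))))
      where i≤e = ≤-trans i≤as as≤e
            cs≡a : cs i ≡ a
            cs≡a = cs-in i a<i i≤e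

  record Raised (i : ℕ) : Set where
    field
      start∈R : inR (cs i) ≡ true
      dropped : μ (suc (cs i)) < μ (cs i)
      inside : i < cs i + stretch (cs i)
      value : Φ i ≡ μ (cs i)

  Φ-excess : ∀ i → 1 ≤ i → i ≤ n → (Φ i ≡ μ i) ⊎ Raised i
  Φ-excess i 1≤i i≤n with Φ-unfold i 1≤i
  ... | inj₁ Φi≡μi = inj₁ Φi≡μi
  ... | inj₂ (R , i<cmin , Φi≡) with μ (cs i) ≤? μ i
  ...   | yes μa≤μi = inj₁ (trans Φi≡ (m≤n⇒m⊔n≡n μa≤μi))
  ...   | no μa≰μi = inj₂ record
            { start∈R = R ; dropped = dropped ; inside = inside
            ; value = trans Φi≡ (m≥n⇒m⊔n≡m (<⇒≤ μi<μa)) }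
    where
      a = cs i
      μi<μa : μ i < μ a
      μi<μa = ≰⇒> μa≰μi
      open CarrelAfter n lam β upβ a R using (core-mono)
      a<i = cs<self i 1≤i
      i≤e = self≤ce i 1≤i i≤n
      dropped : μ (suc a) < μ a
      dropped = ≤-<-trans (core-mono (suc a) i (n<1+n a) a<i i≤e) μi<μa
      inside : i < a + stretch a
      inside with i <? a + stretch a
      ... | yes i<as = i<as
      ... | no i≮as = ⊥-elim (<⇒≱ μi<μa (≤-trans (≤-reflexive (sym (AfterDrop.μas≡μa a R dropped)))
                                            (core-mono (a + stretch a) i (m<m+n a (s≤s z≤n)) (≮⇒≥ i≮as) i≤e)))

  -- Φ is an upper λ-tuple: it is squeezed between μ and values of μ.
  Φ-Upper : Upper n Φ
  Φ-Upper = (λ i 1≤i i≤n → ≤-trans 1≤i (upper i 1≤i i≤n) , Φ≤n i 1≤i i≤n) , upper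
    where
      upper : ∀ i → 1 ≤ i → i ≤ n → i ≤ Φ i
      upper i 1≤i i≤n = ≤-trans (core-upper i 1≤i i≤n) (core≤Φ i 1≤i)
      Φ≤n : ∀ i → 1 ≤ i → i ≤ n → Φ i ≤ n
      Φ≤n i 1≤i i≤n with Φ-excess i 1≤i i≤n
      ... | inj₁ Φi≡μi = ≤-trans (≤-reflexive Φi≡μi) (core≤n i 1≤i i≤n)
      ... | inj₂ r = ≤-trans (≤-reflexive (Raised.value r))
                       (core≤n (cs i) (CarrelAfter.1≤q n lam β upβ (cs i) (Raised.start∈R r))
                                      (<⇒≤ (<-≤-trans (cs<self i 1≤i) i≤n)))

  -- Φ is weakly increasing: a decrease of μ can only happen at a drop, which
  -- Φ bridges at the level μ_a over the whole recovery stretch.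
  Φ-mono : ∀ i → 1 ≤ i → i < n → Φ i ≤ Φ (suc i)
  Φ-mono i 1≤i i<n with Φ-excess i 1≤i (<⇒≤ i<n)
  ... | inj₂ r = ≤-trans (≤-reflexive (Raised.value r))
                   (AfterDrop.μa≤Φ (cs i) (Raised.start∈R r) (Raised.dropped r) (suc i)
                      (≤-trans (cs<self i 1≤i) (n≤1+n i)) (Raised.inside r))
  ... | inj₁ Φi≡μi with μ i ≤? μ (suc i)
  ...   | yes μi≤μsi = ≤-trans (≤-reflexive Φi≡μi) (≤-trans μi≤μsi (core≤Φ (suc i) (s≤s z≤n)))
  ...   | no μi≰μsi with inR i in Ri
  ...     | false = ⊥-elim (μi≰μsi (<⇒≤ (core-strict i 1≤i i<n Ri)))
  ...     | true = ≤-trans (≤-reflexive Φi≡μi)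
                     (AfterDrop.μa≤Φ i Ri (≰⇒> μi≰μsi) (suc i) (n<1+n i) (m<m+n i (s≤s z≤n)))

  Φ-flag : UpperFlag n Φ
  Φ-flag = Φ-Upper , Φ-mono

  -- A tableau bounded by Φ is bounded by μ: in a raised box (j, i) the column
  -- climbs to row k = a + s, where the bound is Φ_k = μ_a, and μ_i lies on
  -- the slope-one line from (k, μ_a).
  Φ-bounded⇒core-bounded : ∀ T → Tableau n lam T → (∀ j i → Box n lam j i → T j i ≤ Φ i) →
                           ∀ j i → Box n lam j i → T j i ≤ μ i
  Φ-bounded⇒core-bounded T tab bounded j i box@(1≤j , j≤λ₁ , 1≤i , i≤cl) with Φ-excess i 1≤i (≤-trans i≤cl (cl≤n j))
  ... | inj₁ Φi≡μi = subst (T j i ≤_) Φi≡μi (bounded j i box)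
  ... | inj₂ r = +-cancelʳ-≤ k (T j i) (μ i) (begin
      T j i + k  ≤⟨ column-climbs n lam T tab j 1≤j j≤λ₁ i k 1≤i (<⇒≤ (Raised.inside r)) k≤cl ⟩
      T j k + i  ≤⟨ +-monoˡ-≤ i (subst (T j k ≤_) Φk≡μa (bounded j k (1≤j , j≤λ₁ , ≤-trans 1≤i (<⇒≤ (Raised.inside r)) , k≤cl))) ⟩
      μ a + i    ≡⟨ sym (on-line i a<i (<⇒≤ (Raised.inside r))) ⟩
      μ i + k    ∎)
    where
      open ≤-Reasoning
      i≤n = ≤-trans i≤cl (cl≤n j)
      a = cs i
      a<i = cs<self i 1≤i
      open AfterDrop a (Raised.start∈R r) (Raised.dropped r)
      k = a + s
      k≤cl : k ≤ cl j
      k≤cl = ≤-trans as≤e (ce≤boundary i 1≤i i≤n (cl j) (isB-column j 1≤j j≤λ₁) i≤cl)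
      a<k = m<m+n a (s≤s z≤n)
      -- row k ends the stretch, so Φ is not raised there
      Φk≡μa : Φ k ≡ μ a
      Φk≡μa with Φ-excess k (1≤-of-< a<k) (≤-trans as≤e e≤n)
      ... | inj₁ Φk≡μk = trans Φk≡μk μas≡μa
      ... | inj₂ r′ = ⊥-elim (<-irrefl refl (subst (λ c → k < c + stretch c) (cs-in k a<k as≤e) (Raised.inside r′)))

  -- S_λ(β) ⊆ S_λ(μ) ⊆ S_λ(Φ) ⊆ S_λ(μ) ⊆ S_λ(β).
  same-S : SameS n lam β Φ
  same-S T = mk⇔
    (λ { (tab , bounded) → tab , λ j i box →
           ≤-trans (entry≤core T (tab , bounded) j i box) (core≤Φ i (proj₁ (proj₂ (proj₂ box)))) })
    (λ { (tab , bounded) → tab , λ j i box@(_ , _ , 1≤i , i≤cl) →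
           ≤-trans (Φ-bounded⇒core-bounded T tab bounded j i box) (core≤β i 1≤i (≤-trans i≤cl (cl≤n j))) })

proposition12p1 : (n : ℕ) → 1 ≤ n → (lam : ℕ → ℕ) → Partition n lam →
    (β : ℕ → ℕ) → Upper n β →
    ((Σ (ℕ → ℕ) (λ φ → UpperFlag n φ × SameS n lam β φ)) ⇔ UGC n lam β) ×
    (UGC n lam β →
       UpperFlag n (Phi n lam (core n lam β)) × SameS n lam β (Phi n lam (core n lam β)))
proposition12p1 n _ lam _ β upβ = mk⇔ necessary sufficient , Φ-works
  where
    Φ-works : UGC n lam β → UpperFlag n (Phi n lam (core n lam β)) × SameS n lam β (Phi n lam (core n lam β))
    Φ-works (_ , gapless) = Sufficiency.Φ-flag n lam β upβ gapless , Sufficiency.same-S n lam β upβ gapless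

    necessary : Σ (ℕ → ℕ) (λ φ → UpperFlag n φ × SameS n lam β φ) → UGC n lam β
    necessary (φ , flag , same) = upβ , Necessity.core-gapless n lam β upβ φ flag same

    sufficient : UGC n lam β → Σ (ℕ → ℕ) (λ φ → UpperFlag n φ × SameS n lam β φ)
    sufficient ugc = Phi n lam (core n lam β) , Φ-works ugc
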